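{- Let $\Gamma$ and $\Sigma$ be regular graphs with coprime valencies, and suppose that both $\Gamma$ and $\Sigma$ are $R$-thin and that $\Sigma$ is vertex-transitive. Let $u,v\in V(\Gamma)$ and $i\in V(\Sigma)$. If there is a walk in $\Gamma$ from $u$ to $v$ of even length, then for any $\sigma\in\mathrm{Aut}(\Gamma\times\Sigma)$ we have $(u,i)^{\sigma\pi_\Sigma}=(v,i)^{\sigma\pi_\Sigma}$.
   Context: Graphs are finite and simple, $\Sigma$ has at least two vertices. The direct product $\Gamma\times\Sigma$ has vertex set $V(\Gamma)\times V(\Sigma)$, with $(u,x)\sim(v,y)$ iff $u\sim v$ in $\Gamma$ and $x\sim y$ in $\Sigma$. A graph is $R$-thin if distinct vertices have distinct neighbourhoods. $\pi_\Sigma:V(\Gamma\times\Sigma)\to V(\Sigma)$ is the projection $(u,i)\mapsto i$; maps act on the right, so $x^{\sigma\pi_\Sigma}$ means apply $\sigma$ then $\pi_\Sigma$. -}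

module Defs where

open import Data.Nat using (ℕ; zero; suc; _*_)
open import Data.Bool using (Bool; true; false)
open import Data.Fin using (Fin; combine; remQuot)
open import Data.Fin.Subset using (Subset; ∣_∣)
open import Data.Vec using (tabulate)
open import Data.Product using (_×_; _,_; proj₁; proj₂; Σ; ∃)
open import Data.Empty using (⊥)
open import Relation.Nullary using (¬_)
open import Relation.Binary.PropositionalEquality using (_≡_; refl; cong₂)
open import Function.Bundles using (_↔_; Inverse)

record Graph (n : ℕ) : Set where
  field
    adj   : Fin n → Fin n → Bool
    irrefl : ∀ x → adj x x ≡ false
    sym   : ∀ x y → adj x y ≡ adj y x
open Graph public

_⊢_~_ : ∀ {n} → Graph n → Fin n → Fin n → Set
G ⊢ x ~ y = adj G x y ≡ true

N : ∀ {n} → Graph n → Fin n → Subset n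
N G x = tabulate (adj G x)

deg : ∀ {n} → Graph n → Fin n → ℕ
deg G x = ∣ N G x ∣

Regular : ∀ {n} → Graph n → ℕ → Set
Regular G k = ∀ x → deg G x ≡ k

RThin : ∀ {n} → Graph n → Set
RThin G = ∀ x y → N G x ≡ N G y → x ≡ y

record Aut {n : ℕ} (G : Graph n) : Set where
  field
    perm : Fin n ↔ Fin n
    pres : ∀ x y → adj G (Inverse.to perm x) (Inverse.to perm y) ≡ adj G x y
open Aut public

apply : ∀ {n} {G : Graph n} → Aut G → Fin n → Fin n
apply σ = Inverse.to (perm σ)

VertexTransitive : ∀ {n} → Graph n → Set
VertexTransitive G = ∀ x y → Σ (Aut G) λ σ → apply σ x ≡ y

data Walk {n : ℕ} (G : Graph n) : Fin n → Fin n → ℕ → Set where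
  [] : ∀ {x} → Walk G x x zero
  _∷_ : ∀ {x y z ℓ} → G ⊢ x ~ y → Walk G y z ℓ → Walk G x z (suc ℓ)

_∧_ : Bool → Bool → Bool
true ∧ b = b
false ∧ _ = false

∧-irrefl-l : ∀ a {b} → a ≡ false → a ∧ b ≡ false
∧-irrefl-l .false refl = refl

-- Direct product Γ × Σ.  Its vertex set V(Γ) × V(Σ) = Fin m × Fin n is
-- encoded as Fin (m * n) via the standard bijection combine / remQuot.

πΓ : ∀ m n → Fin (m * n) → Fin m
πΓ m n p = proj₁ (remQuot {m} n p)

πΣ : ∀ m n → Fin (m * n) → Fin n
πΣ m n p = proj₂ (remQuot {m} n p)

⟨_,_⟩ : ∀ {m n} → Fin m → Fin n → Fin (m * n)
⟨ u , i ⟩ = combine u i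

_⊗_ : ∀ {m n} → Graph m → Graph n → Graph (m * n)
_⊗_ {m} {n} Γ Σ' = record
  { adj = λ p q → adj Γ (πΓ m n p) (πΓ m n q) ∧ adj Σ' (πΣ m n p) (πΣ m n q)
  ; irrefl = λ p → ∧-irrefl-l (adj Γ (πΓ m n p) (πΓ m n p)) (irrefl Γ (πΓ m n p))
  ; sym = λ p q → cong₂ _∧_ (sym Γ (πΓ m n p) (πΓ m n q)) (sym Σ' (πΣ m n p) (πΣ m n q))
  }

-- Let u ~ w ~ v in Γ, write σ(u,i) = (a,p), σ(v,i) = (b,q), and let t = σ⁻¹(a,q).
-- Codegrees (numbers of common neighbours) multiply in Γ × Σ and are preserved by σ.
-- Every common neighbour of (u,i) and (v,i) is adjacent to t, in particular every (w,j)
-- with j ~ i; since Σ is regular and R-thin this forces t = (c,i) for some c.  Comparing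
-- the codegree of (u,i),t with that of their images (a,p),(a,q) gives
-- k · codeg(p,q) = codeg(u,c) · l, so l divides codeg(p,q) by coprimality.  The codegree
-- of (a,p),(b,q) is codeg(u,v) · l > 0 (l > 0 as Σ is R-thin with two vertices), so
-- codeg(p,q) ≠ 0; being at most l, it equals l, which in a regular R-thin graph means
-- p = q.  An even walk is a sequence of such two-edge steps.
module Submission where

open import Defs
open import Data.Nat using (ℕ; _*_; _≥_)
open import Data.Nat.Coprimality using (Coprime)
open import Data.Fin using (Fin)
open import Relation.Binary.PropositionalEquality using (_≡_)

import Algebra.Properties.Semiring.Sum
open import Data.Bool using (Bool; true; false)
open import Data.Bool.Properties using (⇔→≡)
open import Data.Empty using (⊥-elim)
open import Relation.Nullary using (¬_)
open import Data.Fin using (zero; suc; _↑ˡ_; _↑ʳ_; combine)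
open import Data.Fin.Properties using (remQuot-combine; 0≢1+n)
open import Data.Fin.Subset using (_∈_; ⁅_⁆; ∣_∣)
open import Data.Fin.Subset.Properties using (p⊆q⇒∣p∣≤∣q∣; p⊂q⇒∣p∣<∣q∣; ∣⁅x⁆∣≡1; x∈⁅y⁆⇒x≡y)
open import Data.Nat using (zero; suc; _+_; _≤_; s≤s; NonZero; >-nonZero)
import Data.Nat.Coprimality as Coprimality
open import Data.Nat.Divisibility using (_∣_; divides; ∣⇒≤)
open import Data.Nat.Properties using (+-*-semiring; ≤-trans; ≤-reflexive; ≤-antisym; <-irrefl; n≮0; *-suc; +-assoc; m*n≢0; m*n≢0⇒n≢0)
open import Data.Product using (_×_; _,_; proj₁; proj₂)
open import Data.Vec using (tabulate)
open import Data.Vec.Properties using (tabulate-cong; lookup∘tabulate; []=⇒lookup; lookup⇒[]=)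
open import Function.Bundles using (_↔_; Inverse; mk⇔)
open import Relation.Binary.PropositionalEquality as ≡ using (refl; trans; cong; cong₂; subst; _≗_; module ≡-Reasoning)

open Algebra.Properties.Semiring.Sum +-*-semiring using (sum; sum-cong-≗; sum-permute; *-distribˡ-sum; *-distribʳ-sum)

∧-true⁻ : ∀ {a b} → a ∧ b ≡ true → a ≡ true × b ≡ true
∧-true⁻ {true} b≡true = refl , b≡true

∧-true⁺ : ∀ {a b} → a ≡ true → b ≡ true → a ∧ b ≡ true
∧-true⁺ refl refl = refl

∧-idem : ∀ a → a ∧ a ≡ a
∧-idem true  = refl
∧-idem false = refl

∧-interchange : ∀ a b c d → (a ∧ b) ∧ (c ∧ d) ≡ (a ∧ c) ∧ (b ∧ d)
∧-interchange true  b     true  d = refl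
∧-interchange true  true  false d = refl
∧-interchange true  false false d = refl
∧-interchange false b     c     d = refl

indicator : Bool → ℕ
indicator true  = 1
indicator false = 0

indicator-∧ : ∀ a b → indicator (a ∧ b) ≡ indicator a * indicator b
indicator-∧ true  true  = refl
indicator-∧ true  false = refl
indicator-∧ false b     = refl

sum-↑ : ∀ a b (h : Fin (a + b) → ℕ) → sum h ≡ sum (λ i → h (i ↑ˡ b)) + sum (λ j → h (a ↑ʳ j))
sum-↑ zero    b h = refl
sum-↑ (suc a) b h = trans (cong (h zero +_) (sum-↑ a b (λ i → h (suc i)))) (≡.sym (+-assoc (h zero) _ _))

sum-combine : ∀ m n (h : Fin (m * n) → ℕ) → sum h ≡ sum {m} (λ i → sum {n} (λ j → h (combine i j)))
sum-combine zero    n h = refl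
sum-combine (suc m) n h =
  trans (sum-↑ n (m * n) h) (cong (sum (λ j → h (j ↑ˡ (m * n))) +_) (sum-combine m n (λ y → h (n ↑ʳ y))))

count : ∀ {n} → (Fin n → Bool) → ℕ
count f = ∣ tabulate f ∣

∈-tabulate⁺ : ∀ {n} (f : Fin n → Bool) {x} → f x ≡ true → x ∈ tabulate f
∈-tabulate⁺ f {x} fx = lookup⇒[]= x (tabulate f) (trans (lookup∘tabulate f x) fx)

∈-tabulate⁻ : ∀ {n} (f : Fin n → Bool) {x} → x ∈ tabulate f → f x ≡ true
∈-tabulate⁻ f {x} x∈f = trans (≡.sym (lookup∘tabulate f x)) ([]=⇒lookup x∈f)

module _ {n} (f : Fin n → Bool) where

  count-pos : ∀ {x} → f x ≡ true → 1 ≤ count f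
  count-pos {x} fx = ≤-trans (≤-reflexive (≡.sym (∣⁅x⁆∣≡1 x))) (p⊆q⇒∣p∣≤∣q∣ ⁅x⁆⊆f)
    where
    ⁅x⁆⊆f : ∀ {y} → y ∈ ⁅ x ⁆ → y ∈ tabulate f
    ⁅x⁆⊆f y∈⁅x⁆ = subst (_∈ tabulate f) (≡.sym (x∈⁅y⁆⇒x≡y x y∈⁅x⁆)) (∈-tabulate⁺ f fx)

  module _ (g : Fin n → Bool) (f⇒g : ∀ {x} → f x ≡ true → g x ≡ true) where

    private
      f⊆g : ∀ {x} → x ∈ tabulate f → x ∈ tabulate g
      f⊆g x∈f = ∈-tabulate⁺ g (f⇒g (∈-tabulate⁻ f x∈f))

    count-mono : count f ≤ count g
    count-mono = p⊆q⇒∣p∣≤∣q∣ f⊆g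

    count-mono-≡ : count f ≡ count g → ∀ {x} → g x ≡ true → f x ≡ true
    count-mono-≡ eq {x} gx with f x in fx
    ... | true  = refl
    ... | false = ⊥-elim (<-irrefl eq (p⊂q⇒∣p∣<∣q∣ (f⊆g , x , ∈-tabulate⁺ g gx , x∉f)))
      where
      x∉f : ¬ x ∈ tabulate f
      x∉f x∈f with trans (≡.sym fx) (∈-tabulate⁻ f x∈f)
      ... | ()

count-cong : ∀ {n} {f g : Fin n → Bool} → f ≗ g → count f ≡ count g
count-cong f≗g = cong ∣_∣ (tabulate-cong f≗g)

count≡sum : ∀ {n} (f : Fin n → Bool) → count f ≡ sum (λ x → indicator (f x))
count≡sum {zero}  f = refl
count≡sum {suc n} f with f zero
... | true  = cong suc (count≡sum (λ x → f (suc x)))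
... | false = count≡sum (λ x → f (suc x))

count-permute : ∀ {n} (f : Fin n → Bool) (π : Fin n ↔ Fin n) → count (λ x → f (Inverse.to π x)) ≡ count f
count-permute f π = begin
  count (λ x → f (Inverse.to π x))              ≡⟨ count≡sum (λ x → f (Inverse.to π x)) ⟩
  sum (λ x → indicator (f (Inverse.to π x)))    ≡⟨ sum-permute (λ x → indicator (f x)) π ⟨
  sum (λ x → indicator (f x))                   ≡⟨ count≡sum f ⟨
  count f                                       ∎
  where open ≡-Reasoning

module _ {m n} (u : Fin m) (i : Fin n) where

  πΓ-⟨⟩ : πΓ m n ⟨ u , i ⟩ ≡ u
  πΓ-⟨⟩ = cong proj₁ (remQuot-combine u i)

  πΣ-⟨⟩ : πΣ m n ⟨ u , i ⟩ ≡ i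
  πΣ-⟨⟩ = cong proj₂ (remQuot-combine u i)

count-× : ∀ m n (f : Fin m → Bool) (g : Fin n → Bool) →
  count (λ z → f (πΓ m n z) ∧ g (πΣ m n z)) ≡ count f * count g
count-× m n f g = begin
  count fg                                    ≡⟨ count≡sum fg ⟩
  sum (λ z → indicator (fg z))                ≡⟨ sum-combine m n (λ z → indicator (fg z)) ⟩
  sum {m} (λ i → sum {n} (λ j → indicator (fg (combine i j))))
    ≡⟨ sum-cong-≗ (λ i → sum-cong-≗ (λ j → on-pairs i j)) ⟩
  sum (λ i → sum (λ j → F i * G j))           ≡⟨ sum-cong-≗ (λ i → *-distribˡ-sum (F i) G) ⟨
  sum (λ i → F i * sum G)                     ≡⟨ *-distribʳ-sum (sum G) F ⟨
  sum F * sum G                               ≡⟨ cong₂ _*_ (count≡sum f) (count≡sum g) ⟨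
  count f * count g                           ∎
  where
  open ≡-Reasoning
  fg : Fin (m * n) → Bool
  fg z = f (πΓ m n z) ∧ g (πΣ m n z)
  F : Fin m → ℕ
  F i = indicator (f i)
  G : Fin n → ℕ
  G j = indicator (g j)
  on-pairs : ∀ i j → indicator (fg (combine i j)) ≡ F i * G j
  on-pairs i j = trans (cong₂ (λ a b → indicator (f a ∧ g b)) (πΓ-⟨⟩ i j) (πΣ-⟨⟩ i j)) (indicator-∧ (f i) (g j))

module _ {m n} (Γ : Graph m) (Σ' : Graph n) where

  ⊗-~⁻ : ∀ {x y} → (Γ ⊗ Σ') ⊢ x ~ y → Γ ⊢ πΓ m n x ~ πΓ m n y × Σ' ⊢ πΣ m n x ~ πΣ m n y
  ⊗-~⁻ = ∧-true⁻

  ⟨⟩-~-⟨⟩ : ∀ {u w i j} → Γ ⊢ u ~ w → Σ' ⊢ i ~ j → (Γ ⊗ Σ') ⊢ ⟨ u , i ⟩ ~ ⟨ w , j ⟩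
  ⟨⟩-~-⟨⟩ {u} {w} {i} {j} u~w i~j
    rewrite πΓ-⟨⟩ u i | πΓ-⟨⟩ w j | πΣ-⟨⟩ u i | πΣ-⟨⟩ w j
    = ∧-true⁺ u~w i~j

  ⊗-~-mix : ∀ {x z y} → (Γ ⊗ Σ') ⊢ x ~ y → (Γ ⊗ Σ') ⊢ z ~ y → (Γ ⊗ Σ') ⊢ ⟨ πΓ m n x , πΣ m n z ⟩ ~ y
  ⊗-~-mix {x} {z} x~y z~y rewrite πΓ-⟨⟩ (πΓ m n x) (πΣ m n z) | πΣ-⟨⟩ (πΓ m n x) (πΣ m n z)
    = ∧-true⁺ (proj₁ (⊗-~⁻ {x} x~y)) (proj₂ (⊗-~⁻ {z} z~y))

module _ {n} {G : Graph n} (σ : Aut G) where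

  apply⁻¹ : Fin n → Fin n
  apply⁻¹ = Inverse.from (perm σ)

  apply-apply⁻¹ : ∀ x → apply σ (apply⁻¹ x) ≡ x
  apply-apply⁻¹ = Inverse.strictlyInverseˡ (perm σ)

  apply-~⁻ : ∀ {x y} → G ⊢ apply σ x ~ apply σ y → G ⊢ x ~ y
  apply-~⁻ {x} {y} = trans (≡.sym (pres σ x y))

  apply-~⁺ : ∀ {x y} → G ⊢ x ~ y → G ⊢ apply σ x ~ apply σ y
  apply-~⁺ {x} {y} = trans (pres σ x y)

common : ∀ {n} → Graph n → Fin n → Fin n → Fin n → Bool
common G a b y = adj G a y ∧ adj G b y

codeg : ∀ {n} → Graph n → Fin n → Fin n → ℕ
codeg G a b = count (common G a b)

module _ {n} (G : Graph n) where

  common⇒adj : ∀ {a b y} → common G a b y ≡ true → G ⊢ a ~ y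
  common⇒adj e = proj₁ (∧-true⁻ e)

  codeg≤deg : ∀ a b → codeg G a b ≤ deg G a
  codeg≤deg a b = count-mono (common G a b) (adj G a) (common⇒adj {a} {b})

  codeg-pos : ∀ {a b w} → G ⊢ a ~ w → G ⊢ b ~ w → NonZero (codeg G a b)
  codeg-pos {a} {b} a~w b~w = >-nonZero (count-pos (common G a b) (∧-true⁺ a~w b~w))

  codeg-apply : (σ : Aut G) → ∀ x z → codeg G (apply σ x) (apply σ z) ≡ codeg G x z
  codeg-apply σ x z =
    trans (≡.sym (count-permute (common G (apply σ x) (apply σ z)) (perm σ)))
          (count-cong (λ y → cong₂ _∧_ (pres σ x y) (pres σ z y)))

  module _ {l} (reg : Regular G l) where

    codeg-self : ∀ a → codeg G a a ≡ l
    codeg-self a = trans (count-cong (λ y → ∧-idem (adj G a y))) (reg a)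

    module _ (thin : RThin G) where

      N⊆N⇒≡ : ∀ {a b} → (∀ {j} → G ⊢ a ~ j → G ⊢ b ~ j) → a ≡ b
      N⊆N⇒≡ {a} {b} a⇒b = thin a b (tabulate-cong (λ j → ⇔→≡ (mk⇔ a⇒b b⇒a)))
        where
        b⇒a : ∀ {j} → G ⊢ b ~ j → G ⊢ a ~ j
        b⇒a = count-mono-≡ (adj G a) (adj G b) a⇒b (trans (reg a) (≡.sym (reg b)))

      codeg≡valency⇒≡ : ∀ {a b} → codeg G a b ≡ l → a ≡ b
      codeg≡valency⇒≡ {a} {b} eq = N⊆N⇒≡ (λ a~j → proj₂ (∧-true⁻ (adj⇒common a~j)))
        where
        adj⇒common : ∀ {j} → G ⊢ a ~ j → common G a b j ≡ true
        adj⇒common = count-mono-≡ (common G a b) (adj G a) (common⇒adj {a} {b}) (trans eq (≡.sym (reg a)))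

valency-nonZero : ∀ {n} (G : Graph n) {l} → n ≥ 2 → Regular G l → RThin G → NonZero l
valency-nonZero G {suc _} _ _ _ = _
valency-nonZero G {zero} (s≤s (s≤s _)) reg thin = ⊥-elim (0≢1+n (N⊆N⇒≡ G reg thin isolated))
  where
  isolated : ∀ {j} → G ⊢ zero ~ j → G ⊢ suc zero ~ j
  isolated 0~j = ⊥-elim (n≮0 (≤-trans (count-pos (adj G zero) 0~j) (≤-reflexive (reg zero))))

codeg-⊗ : ∀ {m n} (Γ : Graph m) (Σ' : Graph n) x z →
  codeg (Γ ⊗ Σ') x z ≡ codeg Γ (πΓ m n x) (πΓ m n z) * codeg Σ' (πΣ m n x) (πΣ m n z)
codeg-⊗ {m} {n} Γ Σ' x z = trans (count-cong interchange) (count-× m n commonΓ commonΣ)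
  where
  commonΓ : Fin m → Bool
  commonΓ = common Γ (πΓ m n x) (πΓ m n z)
  commonΣ : Fin n → Bool
  commonΣ = common Σ' (πΣ m n x) (πΣ m n z)
  interchange : ∀ y → common (Γ ⊗ Σ') x z y ≡ commonΓ (πΓ m n y) ∧ commonΣ (πΣ m n y)
  interchange y = ∧-interchange (adj Γ (πΓ m n x) (πΓ m n y)) (adj Σ' (πΣ m n x) (πΣ m n y))
                                (adj Γ (πΓ m n z) (πΓ m n y)) (adj Σ' (πΣ m n z) (πΣ m n y))

codeg-⟨⟩-⊗ : ∀ {m n} (Γ : Graph m) (Σ' : Graph n) u i y →
  codeg (Γ ⊗ Σ') ⟨ u , i ⟩ y ≡ codeg Γ u (πΓ m n y) * codeg Σ' i (πΣ m n y)
codeg-⟨⟩-⊗ {m} {n} Γ Σ' u i y =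
  trans (codeg-⊗ Γ Σ' ⟨ u , i ⟩ y)
        (cong₂ (λ a b → codeg Γ a (πΓ m n y) * codeg Σ' b (πΣ m n y)) (πΓ-⟨⟩ u i) (πΣ-⟨⟩ u i))

codeg-⟨⟩-⊗-⟨⟩ : ∀ {m n} (Γ : Graph m) (Σ' : Graph n) u i v j →
  codeg (Γ ⊗ Σ') ⟨ u , i ⟩ ⟨ v , j ⟩ ≡ codeg Γ u v * codeg Σ' i j
codeg-⟨⟩-⊗-⟨⟩ {m} {n} Γ Σ' u i v j =
  trans (codeg-⟨⟩-⊗ Γ Σ' u i ⟨ v , j ⟩) (cong₂ (λ b r → codeg Γ u b * codeg Σ' i r) (πΓ-⟨⟩ v j) (πΣ-⟨⟩ v j))

module _ {m n} (Γ : Graph m) (Σ' : Graph n) {k l : ℕ}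
         (regΓ : Regular Γ k) (regΣ : Regular Σ' l) (coprime : Coprime k l) (thinΣ : RThin Σ')
         {{_ : NonZero l}} (σ : Aut (Γ ⊗ Σ')) where

  private
    Y : Graph (m * n)
    Y = Γ ⊗ Σ'

  σπΣ : Fin (m * n) → Fin n
  σπΣ x = πΣ m n (apply σ x)

  mixed : Fin (m * n) → Fin (m * n) → Fin (m * n)
  mixed x z = apply⁻¹ σ ⟨ πΓ m n (apply σ x) , σπΣ z ⟩

  mixed-~ : ∀ {x z y} → Y ⊢ x ~ y → Y ⊢ z ~ y → Y ⊢ mixed x z ~ y
  mixed-~ {x} {z} {y} x~y z~y =
    apply-~⁻ σ (subst (λ t → Y ⊢ t ~ apply σ y) (≡.sym (apply-apply⁻¹ σ _)) mix~σy)
    where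
    mix~σy : Y ⊢ ⟨ πΓ m n (apply σ x) , σπΣ z ⟩ ~ apply σ y
    mix~σy = ⊗-~-mix Γ Σ' (apply-~⁺ σ x~y) (apply-~⁺ σ z~y)

  codeg-mixed : ∀ x z → codeg Y x (mixed x z) ≡ k * codeg Σ' (σπΣ x) (σπΣ z)
  codeg-mixed x z = begin
    codeg Y x (mixed x z)                                  ≡⟨ codeg-apply Y σ x (mixed x z) ⟨
    codeg Y (apply σ x) (apply σ (mixed x z))              ≡⟨ cong (codeg Y (apply σ x)) (apply-apply⁻¹ σ _) ⟩
    codeg Y (apply σ x) aq                                 ≡⟨ codeg-⊗ Γ Σ' (apply σ x) aq ⟩
    codeg Γ a (πΓ m n aq) * codeg Σ' p (πΣ m n aq)
      ≡⟨ cong₂ (λ b r → codeg Γ a b * codeg Σ' p r) (πΓ-⟨⟩ a q) (πΣ-⟨⟩ a q) ⟩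
    codeg Γ a a * codeg Σ' p q                             ≡⟨ cong (_* codeg Σ' p q) (codeg-self Γ regΓ a) ⟩
    k * codeg Σ' p q                                       ∎
    where
    open ≡-Reasoning
    a = πΓ m n (apply σ x)
    p = σπΣ x
    q = σπΣ z
    aq = ⟨ a , q ⟩

  module _ (i : Fin n) {u w v : Fin m} (u~w : Γ ⊢ u ~ w) (w~v : Γ ⊢ w ~ v) where

    private
      x z : Fin (m * n)
      x = ⟨ u , i ⟩
      z = ⟨ v , i ⟩

      v~w : Γ ⊢ v ~ w
      v~w = trans (sym Γ v w) w~v

    πΣ-mixed : πΣ m n (mixed x z) ≡ i
    πΣ-mixed = ≡.sym (N⊆N⇒≡ Σ' regΣ thinΣ i~j⇒mixed~j)
      where
      i~j⇒mixed~j : ∀ {j} → Σ' ⊢ i ~ j → Σ' ⊢ πΣ m n (mixed x z) ~ j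
      i~j⇒mixed~j {j} i~j = subst (λ j → Σ' ⊢ _ ~ j) (πΣ-⟨⟩ w j)
        (proj₂ (⊗-~⁻ Γ Σ' (mixed-~ {x} {z} (⟨⟩-~-⟨⟩ Γ Σ' u~w i~j) (⟨⟩-~-⟨⟩ Γ Σ' v~w i~j))))

    codeg-σπΣ-nonZero : NonZero (codeg Σ' (σπΣ x) (σπΣ z))
    codeg-σπΣ-nonZero = m*n≢0⇒n≢0 (codeg Γ (πΓ m n X) (πΓ m n Z)) {{subst NonZero codeg-images nonZero}}
      where
      X = apply σ x
      Z = apply σ z
      nonZero : NonZero (codeg Γ u v * l)
      nonZero = m*n≢0 _ _ {{codeg-pos Γ u~w v~w}}
      codeg-images : codeg Γ u v * l ≡ codeg Γ (πΓ m n X) (πΓ m n Z) * codeg Σ' (σπΣ x) (σπΣ z)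
      codeg-images = begin
        codeg Γ u v * l                 ≡⟨ cong (codeg Γ u v *_) (codeg-self Σ' regΣ i) ⟨
        codeg Γ u v * codeg Σ' i i      ≡⟨ codeg-⟨⟩-⊗-⟨⟩ Γ Σ' u i v i ⟨
        codeg Y x z                     ≡⟨ codeg-apply Y σ x z ⟨
        codeg Y X Z                     ≡⟨ codeg-⊗ Γ Σ' X Z ⟩
        codeg Γ (πΓ m n X) (πΓ m n Z) * codeg Σ' (σπΣ x) (σπΣ z) ∎
        where open ≡-Reasoning

    σπΣ-two-step : σπΣ x ≡ σπΣ z
    σπΣ-two-step = codeg≡valency⇒≡ Σ' regΣ thinΣ (≤-antisym d≤l l≤d)
      where
      d = codeg Σ' (σπΣ x) (σπΣ z)
      t = mixed x z
      d≤l : d ≤ l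
      d≤l = ≤-trans (codeg≤deg Σ' (σπΣ x) (σπΣ z)) (≤-reflexive (regΣ (σπΣ x)))
      k*d≡ : k * d ≡ codeg Γ u (πΓ m n t) * l
      k*d≡ = begin
        k * d                                          ≡⟨ codeg-mixed x z ⟨
        codeg Y x t                                    ≡⟨ codeg-⟨⟩-⊗ Γ Σ' u i t ⟩
        codeg Γ u (πΓ m n t) * codeg Σ' i (πΣ m n t)   ≡⟨ cong (λ h → codeg Γ u (πΓ m n t) * codeg Σ' i h) πΣ-mixed ⟩
        codeg Γ u (πΓ m n t) * codeg Σ' i i            ≡⟨ cong (codeg Γ u (πΓ m n t) *_) (codeg-self Σ' regΣ i) ⟩
        codeg Γ u (πΓ m n t) * l                       ∎
        where open ≡-Reasoning
      l∣k*d : l ∣ k * d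
      l∣k*d = divides (codeg Γ u (πΓ m n t)) k*d≡
      l≤d : l ≤ d
      l≤d = ∣⇒≤ {{codeg-σπΣ-nonZero}} (Coprimality.coprime-divisor (Coprimality.sym coprime) l∣k*d)

even-walk-invariant : ∀ {m} {A : Set} {G : Graph m} (f : Fin m → A) →
  (∀ {u w v} → G ⊢ u ~ w → G ⊢ w ~ v → f u ≡ f v) →
  ∀ len {u v} → Walk G u v (2 * len) → f u ≡ f v
even-walk-invariant f two-step zero    []   = refl
even-walk-invariant {G = G} f two-step (suc len) {u} {v} walk = by-two-steps (subst (Walk G u v) (*-suc 2 len) walk)
  where
  by-two-steps : Walk G u v (2 + 2 * len) → f u ≡ f v
  by-two-steps (u~w ∷ (w~x ∷ rest)) = trans (two-step u~w w~x) (even-walk-invariant f two-step len rest)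

lemma5p2 : ∀ {m n : ℕ} (Γ : Graph m) (Σ' : Graph n) (k l : ℕ) →
  n ≥ 2 →
  Regular Γ k → Regular Σ' l → Coprime k l →
  RThin Γ → RThin Σ' → VertexTransitive Σ' →
  (u v : Fin m) (i : Fin n) (len : ℕ) → Walk Γ u v (2 * len) →
  (σ : Aut (Γ ⊗ Σ')) →
  πΣ m n (apply σ ⟨ u , i ⟩) ≡ πΣ m n (apply σ ⟨ v , i ⟩)
lemma5p2 {m} {n} Γ Σ' _ _ n≥2 regΓ regΣ coprime _ thinΣ _ u v i len walk σ =
  even-walk-invariant (λ w → πΣ m n (apply σ ⟨ w , i ⟩))
    (σπΣ-two-step Γ Σ' regΓ regΣ coprime thinΣ {{valency-nonZero Σ' n≥2 regΣ thinΣ}} σ i) len walk
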